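{- For $k\ge 2$, let $G_k$ be the graph obtained from the disjoint union of $k$ copies of the cycle $C_5$ and one additional vertex that is adjacent to exactly one vertex of each of the $k$ copies of $C_5$. Then $\mu(D(G_k))-(n(G_k)+\mu_t(G_k))\ge k-1$.
   Context: All graphs are finite and simple; $n(G)$ is the order of $G$. The double graph $D(G)$ is obtained from the disjoint union of $G$ and a copy $G'$ with $V(G')=\{u': u\in V(G)\}$ by joining each $u\in V(G)$ to all neighbors of $u'$ in $G'$ and each $u'$ to all neighbors of $u$ in $G$. Given $S\subseteq V(H)$, two vertices $x,y$ of $H$ are $S$-visible if some shortest $x,y$-path in $H$ has no internal vertex in $S$. $S$ is a mutual-visibility set if every two vertices of $S$ are $S$-visible; $\mu(H)$ is the maximum size of such a set. $S$ is a total mutual-visibility set if every two vertices of $H$ are $S$-visible; $\mu_t(H)$ is the maximum size of such a set. -}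

module Defs where

open import Data.Nat using (ℕ; zero; suc; _+_; _*_; _≤_; _<_; _≡ᵇ_; _%_; _/_)
open import Data.Bool using (Bool; true; false; _∧_; _∨_)
open import Data.Fin using (Fin; zero; suc; toℕ; fromℕ; inject₁; splitAt)
open import Data.Fin.Subset using (Subset; _∈_; _∉_; ∣_∣)
open import Data.Sum using (inj₁; inj₂)
open import Data.Product using (Σ; ∃; _×_)
open import Relation.Binary.PropositionalEquality using (_≡_; _≢_)
open import Relation.Nullary using (¬_)

-- A finite graph on vertex set Fin n, given by a (boolean) adjacency relation.
-- The concrete graphs below are simple (symmetric, irreflexive) by construction.
record Graph : Set where
  constructor mkGraph
  field
    n   : ℕ
    adj : Fin n → Fin n → Bool

open Graph public

record Walk (G : Graph) (x y : Fin (n G)) (ℓ : ℕ) : Set where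
  field
    vtx   : Fin (suc ℓ) → Fin (n G)
    start : vtx zero ≡ x
    end   : vtx (fromℕ ℓ) ≡ y
    step  : (i : Fin ℓ) → adj G (vtx (inject₁ i)) (vtx (suc i)) ≡ true

open Walk public

IsShortest : (G : Graph) {x y : Fin (n G)} {ℓ : ℕ} → Walk G x y ℓ → Set
IsShortest G {x} {y} {ℓ} _ = (m : ℕ) → m < ℓ → ¬ Walk G x y m

AvoidsInternally : (G : Graph) {x y : Fin (n G)} {ℓ : ℕ} → Walk G x y ℓ → Subset (n G) → Set
AvoidsInternally G {ℓ = ℓ} w S =
  (i : Fin (suc ℓ)) → toℕ i ≢ 0 → toℕ i ≢ ℓ → vtx w i ∉ S

Visible : (G : Graph) → Subset (n G) → Fin (n G) → Fin (n G) → Set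
Visible G S x y =
  Σ ℕ λ ℓ → Σ (Walk G x y ℓ) λ w → IsShortest G w × AvoidsInternally G w S

IsMutualVisibilitySet : (G : Graph) → Subset (n G) → Set
IsMutualVisibilitySet G S = (x y : Fin (n G)) → x ∈ S → y ∈ S → Visible G S x y

IsTotalMutualVisibilitySet : (G : Graph) → Subset (n G) → Set
IsTotalMutualVisibilitySet G S = (x y : Fin (n G)) → Visible G S x y

IsMaxSize : (G : Graph) → (Subset (n G) → Set) → ℕ → Set
IsMaxSize G P m = (Σ (Subset (n G)) λ S → P S × ∣ S ∣ ≡ m)
                × ((S : Subset (n G)) → P S → ∣ S ∣ ≤ m)

IsMu : Graph → ℕ → Set
IsMu G = IsMaxSize G (IsMutualVisibilitySet G)

IsMuT : Graph → ℕ → Set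
IsMuT G = IsMaxSize G (IsTotalMutualVisibilitySet G)

-- Double graph: vertices Fin (n + n); the first n are u ∈ V(G), the last n are the copies u'.
-- Edges: uv, u'v', uv' and u'v for every edge uv of G.
D : Graph → Graph
D G = mkGraph (n G + n G) adjD
  where
  adjD : Fin (n G + n G) → Fin (n G + n G) → Bool
  adjD x y with splitAt (n G) x | splitAt (n G) y
  ... | inj₁ u | inj₁ v = adj G u v
  ... | inj₁ u | inj₂ v = adj G u v
  ... | inj₂ u | inj₁ v = adj G u v
  ... | inj₂ u | inj₂ v = adj G u v

c5step : ℕ → ℕ → Bool
c5step p q = (suc p % 5) ≡ᵇ q

c5adj : ℕ → ℕ → Bool
c5adj p q = c5step p q ∨ c5step q p

-- G_k: vertex zero is the extra vertex; vertex suc i (i < 5k) is position i % 5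
-- of the (i / 5)-th copy of C5. The extra vertex is adjacent to position 0 of each copy.
Gk : ℕ → Graph
Gk k = mkGraph (suc (k * 5)) a
  where
  a : Fin (suc (k * 5)) → Fin (suc (k * 5)) → Bool
  a zero    zero    = false
  a zero    (suc j) = (toℕ j % 5) ≡ᵇ 0
  a (suc i) zero    = (toℕ i % 5) ≡ᵇ 0
  a (suc i) (suc j) = ((toℕ i / 5) ≡ᵇ (toℕ j / 5)) ∧ c5adj (toℕ i % 5) (toℕ j % 5)

-- Every vertex of G_k is the unique common neighbour of two non-adjacent vertices: the hub of
-- the roots of two different copies of C5 (this needs k ≥ 2), a cycle vertex of its two cycle
-- neighbours. So it is internal to the only shortest path between them, and μ_t(G_k) = 0.
-- In D(G_k) let S consist of positions 0, 2, 4 of every copy of C5 in G and positions 1, 2, 4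
-- of every copy in G′ (position 0 is the root, adjacent to the hub). Each of the positions
-- 0, 1, 3 then has a vertex outside S, and these suffice as internal vertices: two vertices of
-- S in one copy are at distance at most 2 with a common neighbour outside S when not adjacent,
-- and between different copies a shortest path runs down to the roots and through the hub,
-- which is not in S either. Hence μ(D(G_k)) ≥ |S| = 6k = (k − 1) + n(G_k) + μ_t(G_k).

module Submission where

open import Defs
open import Data.Nat using (ℕ; _+_; _∸_; _≤_)
open import Data.Nat as ℕ using (zero; suc; _*_; z≤n; s≤s; _≡ᵇ_; _%_; _/_; _⊓_; ∣_-_∣)
open import Data.Nat.Properties as ℕ using ()
open import Data.Nat.DivMod using ([m+kn]%n≡m%n; m<n⇒m%n≡m; +-distrib-/-∣ʳ; m<n⇒m/n≡0; m*n/n≡m)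
open import Data.Nat.Divisibility using (n∣m*n)
open import Data.Nat.Tactic.RingSolver using (solve-∀)
open import Data.Bool using (Bool; true; false; T; _∧_)
open import Data.Bool.Properties as Bool using ()
open import Data.Fin using (Fin; zero; suc; toℕ; fromℕ; inject₁; _≟_; _↑ˡ_; _↑ʳ_; splitAt; join; combine; remQuot)
open import Data.Fin.Properties as Fin
  using (all?; any?; toℕ<n; toℕ-injective; splitAt-↑ˡ; splitAt-↑ʳ; join-splitAt; toℕ-combine; combine-remQuot;
         remQuot-combine; combine-injectiveˡ; combine-injectiveʳ)
open import Data.Fin.Subset using (Subset; _∈_; _∉_; ⊥; ∣_∣; inside; outside; Empty)
open import Data.Fin.Subset.Properties using (∉⊥; Empty-unique; ∣⊥∣≡0)
open import Data.Vec using ([]; _∷_; lookup; _++_; concat; replicate)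
open import Data.Vec.Properties using (lookup-++ˡ; lookup-++ʳ; lookup-concat; lookup-replicate; []=⇒lookup)
open import Data.Sum using (inj₁; inj₂; [_,_]′)
open import Data.Product using (∃; ∃₂; _×_; _,_; proj₁; uncurry)
open import Function using (_∘_; id)
open import Relation.Binary.PropositionalEquality
open import Relation.Nullary using (Dec; yes; no; contradiction)
open import Relation.Nullary.Decidable using (¬?; from-yes; map′; _×-dec_; _⊎-dec_; _→-dec_)

∣p++q∣≡∣p∣+∣q∣ : ∀ {m n} (p : Subset m) (q : Subset n) → ∣ p ++ q ∣ ≡ ∣ p ∣ + ∣ q ∣
∣p++q∣≡∣p∣+∣q∣ []            q = refl
∣p++q∣≡∣p∣+∣q∣ (true  ∷ p) q = cong suc (∣p++q∣≡∣p∣+∣q∣ p q)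
∣p++q∣≡∣p∣+∣q∣ (false ∷ p) q = ∣p++q∣≡∣p∣+∣q∣ p q

∣concat-replicate∣ : ∀ {m} k (p : Subset m) → ∣ concat (replicate k p) ∣ ≡ k * ∣ p ∣
∣concat-replicate∣ zero    p = refl
∣concat-replicate∣ (suc k) p =
  trans (∣p++q∣≡∣p∣+∣q∣ p (concat (replicate k p))) (cong (∣ p ∣ +_) (∣concat-replicate∣ k p))

≡ᵇ-refl : ∀ m → (m ≡ᵇ m) ≡ true
≡ᵇ-refl zero    = refl
≡ᵇ-refl (suc m) = ≡ᵇ-refl m

≡ᵇ-true⇒≡ : ∀ {m n} → (m ≡ᵇ n) ≡ true → m ≡ n
≡ᵇ-true⇒≡ {m} {n} e = ℕ.≡ᵇ⇒≡ m n (subst T (sym e) _)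

toℕ≡ᵇ0⇒zero : ∀ {m} {i : Fin (suc m)} → (toℕ i ≡ᵇ 0) ≡ true → i ≡ zero
toℕ≡ᵇ0⇒zero {i = zero} _ = refl

∧-true⇒ : ∀ {a b} → a ∧ b ≡ true → a ≡ true × b ≡ true
∧-true⇒ {true} e = refl , e

≡ᵇ-comm : ∀ m n → (m ≡ᵇ n) ≡ (n ≡ᵇ m)
≡ᵇ-comm zero    zero    = refl
≡ᵇ-comm zero    (suc n) = refl
≡ᵇ-comm (suc m) zero    = refl
≡ᵇ-comm (suc m) (suc n) = ≡ᵇ-comm m n

∀-Bool? : {P : Bool → Set} → (∀ b → Dec (P b)) → Dec (∀ b → P b)
∀-Bool? P? = map′ (λ (f , t) → λ { false → f ; true → t }) (λ h → h false , h true)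
                  (P? false ×-dec P? true)

∃-Bool? : {P : Bool → Set} → (∀ b → Dec (P b)) → Dec (∃ P)
∃-Bool? P? = map′ [ (false ,_) , (true ,_) ]′ (λ { (false , x) → inj₁ x ; (true , x) → inj₂ x })
                  (P? false ⊎-dec P? true)

-- Walks whose internal vertices avoid a set

module _ (H : Graph) where

  data ClearWalk (S : Subset (n H)) : Fin (n H) → Fin (n H) → ℕ → Set where
    stay : ∀ {x} → ClearWalk S x x 0
    edge : ∀ {x y} → adj H x y ≡ true → ClearWalk S x y 1
    via  : ∀ {x u y ℓ} → adj H x u ≡ true → u ∉ S → ClearWalk S u y (suc ℓ) →
           ClearWalk S x y (suc (suc ℓ))

  module _ {S : Subset (n H)} where

    vertices : ∀ {x y ℓ} → ClearWalk S x y ℓ → Fin (suc ℓ) → Fin (n H)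
    vertices {x} _ zero = x
    vertices stay (suc ())
    vertices (edge {y = y} _) (suc zero) = y
    vertices (via _ _ w) (suc i) = vertices w i

    vertices-end : ∀ {x y ℓ} (w : ClearWalk S x y ℓ) → vertices w (fromℕ ℓ) ≡ y
    vertices-end stay = refl
    vertices-end (edge _) = refl
    vertices-end (via _ _ w) = vertices-end w

    vertices-step : ∀ {x y ℓ} (w : ClearWalk S x y ℓ) (i : Fin ℓ) →
                    adj H (vertices w (inject₁ i)) (vertices w (suc i)) ≡ true
    vertices-step (edge e) zero = e
    vertices-step (via e _ (edge _)) zero = e
    vertices-step (via e _ (via _ _ _)) zero = e
    vertices-step (via _ _ w) (suc i) = vertices-step w i

    toWalk : ∀ {x y ℓ} → ClearWalk S x y ℓ → Walk H x y ℓ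
    toWalk w = record { vtx = vertices w ; start = refl ; end = vertices-end w ; step = vertices-step w }

    toWalk-avoids : ∀ {x y ℓ} (w : ClearWalk S x y ℓ) → AvoidsInternally H (toWalk w) S
    toWalk-avoids w zero first _ = contradiction refl first
    toWalk-avoids (edge _) (suc zero) _ last = contradiction refl last
    toWalk-avoids (via _ u∉S (edge _)) (suc zero) _ _ = u∉S
    toWalk-avoids (via _ u∉S (via _ _ _)) (suc zero) _ _ = u∉S
    toWalk-avoids (via _ _ w) (suc (suc i)) _ last =
      toWalk-avoids w (suc i) (λ ()) (λ eq → last (cong suc eq))

    splice : ∀ {x u y a b} → ClearWalk S x u (suc a) → u ∉ S → ClearWalk S u y (suc b) →
             ClearWalk S x y (suc a + suc b)
    splice (edge xu)        u∉S w = via xu u∉S w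
    splice (via xv v∉S w′) u∉S w = via xv v∉S (splice w′ u∉S w)

    snoc : ∀ {x u y ℓ} → ClearWalk S x u (suc ℓ) → u ∉ S → adj H u y ≡ true →
           ClearWalk S x y (suc (suc ℓ))
    snoc (edge xu)       u∉S uy = via xu u∉S (edge uy)
    snoc (via xv v∉S w) u∉S uy = via xv v∉S (snoc w u∉S uy)

    reverse : (∀ u v → adj H u v ≡ adj H v u) → ∀ {x y ℓ} → ClearWalk S x y ℓ → ClearWalk S y x ℓ
    reverse sym-adj stay = stay
    reverse sym-adj (edge xy) = edge (trans (sym-adj _ _) xy)
    reverse sym-adj (via xu u∉S w) = snoc (reverse sym-adj w) u∉S (trans (sym-adj _ _) xu)

  walk-potential : (f : Fin (n H) → ℕ) → (∀ u v → adj H u v ≡ true → f v ≤ suc (f u)) →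
                   ∀ {x y m} → Walk H x y m → f y ≤ m + f x
  walk-potential f lip {m = m} w =
    subst₂ (λ a b → f a ≤ m + f b) (end w) (start w) (along m (vtx w) (step w))
    where
    along : ∀ m (v : Fin (suc m) → Fin (n H)) →
            ((i : Fin m) → adj H (v (inject₁ i)) (v (suc i)) ≡ true) →
            f (v (fromℕ m)) ≤ m + f (v zero)
    along zero v _ = ℕ.≤-refl
    along (suc m) v st = begin
      f (v (fromℕ (suc m)))      ≤⟨ along m (v ∘ suc) (st ∘ suc) ⟩
      m + f (v (suc zero))       ≤⟨ ℕ.+-monoʳ-≤ m (lip _ _ (st zero)) ⟩
      m + suc (f (v zero))       ≡⟨ ℕ.+-suc m _ ⟩
      suc m + f (v zero)         ∎
      where open ℕ.≤-Reasoning

  walk-length-0 : ∀ {x y} → Walk H x y 0 → x ≡ y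
  walk-length-0 w = trans (sym (start w)) (end w)

  walk-length-1 : ∀ {x y} → Walk H x y 1 → adj H x y ≡ true
  walk-length-1 w = subst₂ (λ a b → adj H a b ≡ true) (start w) (end w) (step w zero)

  geodesic-visible : ∀ {S x y ℓ} (w : ClearWalk S x y ℓ) →
                     (∀ {m} → Walk H x y m → ℓ ≤ m) → Visible H S x y
  geodesic-visible {ℓ = ℓ} w lower =
    ℓ , toWalk w , (λ m m<ℓ w′ → ℕ.<⇒≱ m<ℓ (lower w′)) , toWalk-avoids w

  visible-if-common-neighbour : ∀ {S} x y →
    (adj H x y ≡ false → ∃ λ u → adj H x u ≡ true × u ∉ S × adj H u y ≡ true) →
    Visible H S x y
  visible-if-common-neighbour x y middle with x ≟ y | adj H x y in xy
  ... | yes refl | _ = geodesic-visible stay (λ _ → z≤n)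
  ... | no x≢y | true = geodesic-visible (edge xy) at-least-1
    where
    at-least-1 : ∀ {m} → Walk H x y m → 1 ≤ m
    at-least-1 {zero} w = contradiction (walk-length-0 w) x≢y
    at-least-1 {suc m} w = s≤s z≤n
  ... | no x≢y | false with middle refl
  ...   | u , xu , u∉S , uy = geodesic-visible (via xu u∉S (edge uy)) at-least-2
    where
    at-least-2 : ∀ {m} → Walk H x y m → 2 ≤ m
    at-least-2 {zero} w = contradiction (walk-length-0 w) x≢y
    at-least-2 {suc zero} w with () ← trans (sym (walk-length-1 w)) xy
    at-least-2 {suc (suc m)} w = s≤s (s≤s z≤n)

  IsUniqueMiddle : Fin (n H) → Fin (n H) → Fin (n H) → Set
  IsUniqueMiddle x u y = x ≢ y × adj H x y ≡ false × adj H x u ≡ true × adj H u y ≡ true ×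
                         (∀ v → adj H x v ≡ true → adj H v y ≡ true → v ≡ u)

  unique-middle-∉ : ∀ {T x u y} → IsUniqueMiddle x u y → Visible H T x y → u ∉ T
  unique-middle-∉ (x≢y , _) (zero , w , _) = contradiction (walk-length-0 w) x≢y
  unique-middle-∉ (_ , xy , _) (suc zero , w , _) with () ← trans (sym (walk-length-1 w)) xy
  unique-middle-∉ {T} {x} {u} {y} (_ , _ , _ , _ , unique) (suc (suc zero) , w , _ , avoids) =
    subst (_∉ T) (unique (vtx w (suc zero)) x-mid mid-y) (avoids (suc zero) (λ ()) (λ ()))
    where
    x-mid : adj H x (vtx w (suc zero)) ≡ true
    x-mid = subst (λ a → adj H a (vtx w (suc zero)) ≡ true) (start w) (step w zero)
    mid-y : adj H (vtx w (suc zero)) y ≡ true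
    mid-y = subst (λ b → adj H (vtx w (suc zero)) b ≡ true) (end w) (step w (suc zero))
  unique-middle-∉ (_ , _ , xu , uy , _) (suc (suc (suc ℓ)) , _ , shortest , _) =
    -- every walk avoids the empty set internally, in particular x u y
    contradiction (toWalk {S = ⊥} (via xu ∉⊥ (edge uy))) (shortest 2 (s≤s (s≤s (s≤s z≤n))))

  total-mutual-visibility-empty : (∀ u → ∃₂ λ x y → IsUniqueMiddle x u y) →
                                  ∀ {T} → IsTotalMutualVisibilitySet H T → ∣ T ∣ ≡ 0
  total-mutual-visibility-empty middles {T} total =
    trans (cong ∣_∣ (Empty-unique no-member)) (∣⊥∣≡0 (n H))
    where
    no-member : Empty T
    no-member (u , u∈T) with middles u
    ... | x , y , middle = unique-middle-∉ middle (total x y) u∈T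

-- Double graphs

module Double (G : Graph) where

  layer : Bool → Fin (n G) → Fin (n (D G))
  layer false u = u ↑ˡ n G
  layer true  u = n G ↑ʳ u

  base : Fin (n (D G)) → Fin (n G)
  base x = [ id , id ]′ (splitAt (n G) x)

  base-layer : ∀ l u → base (layer l u) ≡ u
  base-layer false u = cong [ id , id ]′ (splitAt-↑ˡ (n G) u (n G))
  base-layer true  u = cong [ id , id ]′ (splitAt-↑ʳ (n G) (n G) u)

  adj-D : ∀ x y → adj (D G) x y ≡ adj G (base x) (base y)
  adj-D x y with splitAt (n G) x | splitAt (n G) y
  ... | inj₁ _ | inj₁ _ = refl
  ... | inj₁ _ | inj₂ _ = refl
  ... | inj₂ _ | inj₁ _ = refl
  ... | inj₂ _ | inj₂ _ = refl

  adj-D-layer : ∀ l l′ u v → adj (D G) (layer l u) (layer l′ v) ≡ adj G u v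
  adj-D-layer l l′ u v = trans (adj-D _ _) (cong₂ (adj G) (base-layer l u) (base-layer l′ v))

  data Layered : Fin (n (D G)) → Set where
    layered : ∀ l u → Layered (layer l u)

  layered-view : ∀ x → Layered x
  layered-view x = subst Layered (join-splitAt (n G) (n G) x) (from (splitAt (n G) x))
    where
    from : ∀ s → Layered (join (n G) (n G) s)
    from (inj₁ u) = layered false u
    from (inj₂ u) = layered true u

  layer-walk-potential : (f : Fin (n G) → ℕ) → (∀ u v → adj G u v ≡ true → f v ≤ suc (f u)) →
                         ∀ {l l′ u v m} → Walk (D G) (layer l u) (layer l′ v) m → f v ≤ m + f u
  layer-walk-potential f lip {l} {l′} {u} {v} {m} w =
    subst₂ (λ a b → f a ≤ m + f b) (base-layer l′ v) (base-layer l u)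
      (walk-potential (D G) (f ∘ base) lip-base w)
    where
    lip-base : ∀ x y → adj (D G) x y ≡ true → f (base y) ≤ suc (f (base x))
    lip-base x y xy = lip (base x) (base y) (trans (sym (adj-D x y)) xy)

  D-symmetric : (∀ u v → adj G u v ≡ adj G v u) → ∀ x y → adj (D G) x y ≡ adj (D G) y x
  D-symmetric sym-adj x y =
    trans (adj-D x y) (trans (sym-adj (base x) (base y)) (sym (adj-D y x)))

  lookup-layer : ∀ (A : Bool → Subset (n G)) l u →
                 lookup (A false ++ A true) (layer l u) ≡ lookup (A l) u
  lookup-layer A false u = lookup-++ˡ (A false) (A true) u
  lookup-layer A true  u = lookup-++ʳ (A false) (A true) u

-- The cycle C5 and the graphs G_k

C5 : Fin 5 → Fin 5 → Bool
C5 p q = c5adj (toℕ p) (toℕ q)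

c5dist : Fin 5 → Fin 5 → ℕ
c5dist p q = d ⊓ (5 ∸ d)
  where d = ∣ toℕ p - toℕ q ∣

S₅ : Bool → Subset 5
S₅ false = inside  ∷ outside ∷ inside ∷ outside ∷ inside ∷ []
S₅ true  = outside ∷ inside  ∷ inside ∷ outside ∷ inside ∷ []

-- Abstract, so that the decision procedures are not unfolded where these facts are used.
abstract
  c5dist-self : ∀ p → c5dist p p ≡ 0
  c5dist-self = from-yes (all? λ p → c5dist p p ℕ.≟ 0)

  c5dist-sym : ∀ p q → c5dist p q ≡ c5dist q p
  c5dist-sym = from-yes (all? λ p → all? λ q → c5dist p q ℕ.≟ c5dist q p)

  c5dist-lipschitz : ∀ a p q → C5 p q ≡ true → c5dist a q ≤ suc (c5dist a p)
  c5dist-lipschitz = from-yes (all? λ a → all? λ p → all? λ q →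
    (C5 p q Bool.≟ true) →-dec (c5dist a q ℕ.≤? suc (c5dist a p)))

  S₅-common-neighbour : ∀ l p l′ q →
    lookup (S₅ l) p ≡ inside → lookup (S₅ l′) q ≡ inside → C5 p q ≡ false →
    ∃₂ λ l″ r → lookup (S₅ l″) r ≡ outside × C5 p r ≡ true × C5 r q ≡ true
  S₅-common-neighbour = from-yes (∀-Bool? λ l → all? λ p → ∀-Bool? λ l′ → all? λ q →
    (lookup (S₅ l) p Bool.≟ inside) →-dec (lookup (S₅ l′) q Bool.≟ inside) →-dec
    (C5 p q Bool.≟ false) →-dec
    ∃-Bool? λ l″ → any? λ r →
      (lookup (S₅ l″) r Bool.≟ outside) ×-dec (C5 p r Bool.≟ true) ×-dec (C5 r q Bool.≟ true))

  c5-unique-middle : ∀ p → ∃₂ λ a b → a ≢ b × C5 a b ≡ false × C5 a p ≡ true × C5 p b ≡ true ×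
                                     (∀ r → C5 a r ≡ true → C5 r b ≡ true → r ≡ p)
  c5-unique-middle = from-yes (all? λ p → any? λ a → any? λ b →
    ¬? (a ≟ b) ×-dec (C5 a b Bool.≟ false) ×-dec (C5 a p Bool.≟ true) ×-dec (C5 p b Bool.≟ true) ×-dec
    all? λ r → (C5 a r Bool.≟ true) →-dec (C5 r b Bool.≟ true) →-dec (r ≟ p))

Gk-symmetric : ∀ k u v → adj (Gk k) u v ≡ adj (Gk k) v u
Gk-symmetric k zero    zero    = refl
Gk-symmetric k zero    (suc j) = refl
Gk-symmetric k (suc i) zero    = refl
Gk-symmetric k (suc i) (suc j) =
  cong₂ _∧_ (≡ᵇ-comm (toℕ i / 5) (toℕ j / 5)) (Bool.∨-comm (c5step (toℕ i % 5) (toℕ j % 5)) _)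

module Cycles (k : ℕ) where

  hub : Fin (n (Gk k))
  hub = zero

  cyc : Fin k → Fin 5 → Fin (n (Gk k))
  cyc c p = suc (combine c p)

  toℕ-combine′ : ∀ (c : Fin k) (p : Fin 5) → toℕ (combine c p) ≡ toℕ p + toℕ c * 5
  toℕ-combine′ c p = begin
    toℕ (combine c p)   ≡⟨ toℕ-combine c p ⟩
    5 * toℕ c + toℕ p   ≡⟨ ℕ.+-comm (5 * toℕ c) (toℕ p) ⟩
    toℕ p + 5 * toℕ c   ≡⟨ cong (toℕ p +_) (ℕ.*-comm 5 (toℕ c)) ⟩
    toℕ p + toℕ c * 5   ∎
    where open ≡-Reasoning

  combine-%5 : ∀ (c : Fin k) (p : Fin 5) → toℕ (combine c p) % 5 ≡ toℕ p
  combine-%5 c p = begin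
    toℕ (combine c p) % 5     ≡⟨ cong (_% 5) (toℕ-combine′ c p) ⟩
    (toℕ p + toℕ c * 5) % 5   ≡⟨ [m+kn]%n≡m%n (toℕ p) (toℕ c) 5 ⟩
    toℕ p % 5                 ≡⟨ m<n⇒m%n≡m (toℕ<n p) ⟩
    toℕ p                     ∎
    where open ≡-Reasoning

  combine-/5 : ∀ (c : Fin k) (p : Fin 5) → toℕ (combine c p) / 5 ≡ toℕ c
  combine-/5 c p = begin
    toℕ (combine c p) / 5       ≡⟨ cong (_/ 5) (toℕ-combine′ c p) ⟩
    (toℕ p + toℕ c * 5) / 5     ≡⟨ +-distrib-/-∣ʳ (toℕ p) (n∣m*n (toℕ c)) ⟩
    toℕ p / 5 + toℕ c * 5 / 5   ≡⟨ cong₂ _+_ (m<n⇒m/n≡0 (toℕ<n p)) (m*n/n≡m (toℕ c) 5) ⟩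
    toℕ c                       ∎
    where open ≡-Reasoning

  adj-hub-cyc : ∀ c p → adj (Gk k) hub (cyc c p) ≡ (toℕ p ≡ᵇ 0)
  adj-hub-cyc c p = cong (_≡ᵇ 0) (combine-%5 c p)

  adj-cyc-hub : ∀ c p → adj (Gk k) (cyc c p) hub ≡ (toℕ p ≡ᵇ 0)
  adj-cyc-hub c p = cong (_≡ᵇ 0) (combine-%5 c p)

  adj-cyc-cyc : ∀ c c′ p q → adj (Gk k) (cyc c p) (cyc c′ q) ≡ (toℕ c ≡ᵇ toℕ c′) ∧ C5 p q
  adj-cyc-cyc c c′ p q
    rewrite combine-/5 c p | combine-/5 c′ q | combine-%5 c p | combine-%5 c′ q = refl

  adj-cyc-same : ∀ c p q → adj (Gk k) (cyc c p) (cyc c q) ≡ C5 p q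
  adj-cyc-same c p q = trans (adj-cyc-cyc c c p q) (cong (_∧ C5 p q) (≡ᵇ-refl (toℕ c)))

  adj-cyc-cyc⇒ : ∀ {c c′ p q} → adj (Gk k) (cyc c p) (cyc c′ q) ≡ true → c ≡ c′ × C5 p q ≡ true
  adj-cyc-cyc⇒ {c} {c′} {p} {q} e with ∧-true⇒ (trans (sym (adj-cyc-cyc c c′ p q)) e)
  ... | same , pq = toℕ-injective (≡ᵇ-true⇒≡ same) , pq

  data Vertex : Fin (n (Gk k)) → Set where
    hubᵛ : Vertex hub
    cycᵛ : ∀ c p → Vertex (cyc c p)

  vertex-view : ∀ v → Vertex v
  vertex-view zero    = hubᵛ
  vertex-view (suc j) = subst (Vertex ∘ suc) (combine-remQuot {k} 5 j) (cycᵛ _ _)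

module UniqueMiddles (k : ℕ) where
  open Cycles k

  hub-unique-middle : ∀ {c c′} → c ≢ c′ → IsUniqueMiddle (Gk k) (cyc c zero) hub (cyc c′ zero)
  hub-unique-middle {c} {c′} c≢c′ =
    (λ eq → c≢c′ (combine-injectiveˡ c zero c′ zero (Fin.suc-injective eq))) ,
    Bool.¬-not (λ adjacent → c≢c′ (proj₁ (adj-cyc-cyc⇒ adjacent))) ,
    adj-cyc-hub c zero , adj-hub-cyc c′ zero , only-hub
    where
    only-hub : ∀ v → adj (Gk k) (cyc c zero) v ≡ true → adj (Gk k) v (cyc c′ zero) ≡ true → v ≡ hub
    only-hub v cv vc′ with vertex-view v
    ... | hubᵛ      = refl
    ... | cycᵛ c″ r = contradiction (trans (proj₁ (adj-cyc-cyc⇒ cv)) (proj₁ (adj-cyc-cyc⇒ vc′))) c≢c′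

  cyc-unique-middle : ∀ c p → ∃₂ λ x y → IsUniqueMiddle (Gk k) x (cyc c p) y
  cyc-unique-middle c p with c5-unique-middle p
  ... | a , b , a≢b , ab , ap , pb , unique =
    cyc c a , cyc c b ,
    (λ eq → a≢b (combine-injectiveʳ c a c b (Fin.suc-injective eq))) ,
    trans (adj-cyc-same c a b) ab , trans (adj-cyc-same c a p) ap , trans (adj-cyc-same c p b) pb ,
    only-p
    where
    only-p : ∀ v → adj (Gk k) (cyc c a) v ≡ true → adj (Gk k) v (cyc c b) ≡ true → v ≡ cyc c p
    only-p v av vb with vertex-view v
    ... | hubᵛ = contradiction (trans a≡0 (sym b≡0)) a≢b
      where
      a≡0 : a ≡ zero
      a≡0 = toℕ≡ᵇ0⇒zero (trans (sym (adj-cyc-hub c a)) av)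
      b≡0 : b ≡ zero
      b≡0 = toℕ≡ᵇ0⇒zero (trans (sym (adj-hub-cyc c b)) vb)
    ... | cycᵛ c″ r with adj-cyc-cyc⇒ av | adj-cyc-cyc⇒ vb
    ...   | refl , ar | _ , rb = cong (cyc c) (unique r ar rb)

  every-vertex-unique-middle : 2 ≤ k → ∀ v → ∃₂ λ x y → IsUniqueMiddle (Gk k) x v y
  every-vertex-unique-middle (s≤s (s≤s _)) v with vertex-view v
  ... | hubᵛ     = cyc zero zero , cyc (suc zero) zero , hub-unique-middle {zero} {suc zero} λ ()
  ... | cycᵛ c p = cyc-unique-middle c p

module Potential {k : ℕ} (c : Fin k) (p : Fin 5) where
  open Cycles k

  -- φ u is the distance from cyc c p to u in G_k; only its 1-Lipschitz property is used.
  height : Fin k → Fin 5 → ℕ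
  height c′ r with c′ ≟ c
  ... | yes _ = c5dist p r
  ... | no  _ = c5dist zero r + suc (suc (c5dist p zero))

  φ : Fin (n (Gk k)) → ℕ
  φ zero    = suc (c5dist p zero)
  φ (suc j) = uncurry height (remQuot 5 j)

  φ-cyc : ∀ c′ r → φ (cyc c′ r) ≡ height c′ r
  φ-cyc c′ r = cong (uncurry height) (remQuot-combine c′ r)

  φ-source : φ (cyc c p) ≡ 0
  φ-source rewrite φ-cyc c p with c ≟ c
  ... | yes _  = c5dist-self p
  ... | no c≢c = contradiction refl c≢c

  φ-other : ∀ {c′} r → c′ ≢ c → φ (cyc c′ r) ≡ c5dist zero r + suc (suc (c5dist p zero))
  φ-other {c′} r c′≢c rewrite φ-cyc c′ r with c′ ≟ c
  ... | yes c′≡c = contradiction c′≡c c′≢c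
  ... | no _     = refl

  private
    hub-root : ∀ c′ → height c′ zero ≤ suc (suc (c5dist p zero))
    hub-root c′ with c′ ≟ c
    ... | yes _ = ℕ.m≤n⇒m≤1+n (ℕ.n≤1+n _)
    ... | no  _ = ℕ.≤-refl

    root-hub : ∀ c′ → suc (c5dist p zero) ≤ suc (height c′ zero)
    root-hub c′ with c′ ≟ c
    ... | yes _ = ℕ.≤-refl
    ... | no  _ = ℕ.m≤n⇒m≤1+n (ℕ.n≤1+n _)

    along-cycle : ∀ c′ {r s} → C5 r s ≡ true → height c′ s ≤ suc (height c′ r)
    along-cycle c′ {r} {s} rs with c′ ≟ c
    ... | yes _ = c5dist-lipschitz p r s rs
    ... | no  _ = ℕ.+-monoˡ-≤ _ (c5dist-lipschitz zero r s rs)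

  φ-lipschitz : ∀ u v → adj (Gk k) u v ≡ true → φ v ≤ suc (φ u)
  φ-lipschitz u v uv with vertex-view u | vertex-view v
  ... | hubᵛ | hubᵛ = contradiction uv λ ()
  ... | hubᵛ | cycᵛ c′ r with refl ← toℕ≡ᵇ0⇒zero {i = r} (trans (sym (adj-hub-cyc c′ r)) uv)
    rewrite φ-cyc c′ zero = hub-root c′
  ... | cycᵛ c′ r | hubᵛ with refl ← toℕ≡ᵇ0⇒zero {i = r} (trans (sym (adj-cyc-hub c′ r)) uv)
    rewrite φ-cyc c′ zero = root-hub c′
  ... | cycᵛ c′ r | cycᵛ c″ s with adj-cyc-cyc⇒ uv
  ...   | refl , rs rewrite φ-cyc c′ r | φ-cyc c′ s = along-cycle c′ rs

-- A mutual-visibility set of D(G_k)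

module DoubleCycles (k : ℕ) where
  open Cycles k
  open Double (Gk k)

  private
    DG : Graph
    DG = D (Gk k)

  cycD : Bool → Fin k → Fin 5 → Fin (n DG)
  cycD l c p = layer l (cyc c p)

  hubD : Bool → Fin (n DG)
  hubD l = layer l hub

  adj-cycD-same : ∀ l l′ c p q → adj DG (cycD l c p) (cycD l′ c q) ≡ C5 p q
  adj-cycD-same l l′ c p q = trans (adj-D-layer l l′ _ _) (adj-cyc-same c p q)

  adj-cycD-hubD : ∀ l l′ c p → adj DG (cycD l c p) (hubD l′) ≡ (toℕ p ≡ᵇ 0)
  adj-cycD-hubD l l′ c p = trans (adj-D-layer l l′ _ _) (adj-cyc-hub c p)

  onCycles : Subset 5 → Subset (n (Gk k))
  onCycles r = outside ∷ concat (replicate k r)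

  S : Subset (n DG)
  S = onCycles (S₅ false) ++ onCycles (S₅ true)

  ∣S∣ : ∣ S ∣ ≡ k * 3 + k * 3
  ∣S∣ = trans (∣p++q∣≡∣p∣+∣q∣ (onCycles (S₅ false)) (onCycles (S₅ true)))
              (cong₂ _+_ (∣concat-replicate∣ k (S₅ false)) (∣concat-replicate∣ k (S₅ true)))

  lookup-S-cycD : ∀ l c p → lookup S (cycD l c p) ≡ lookup (S₅ l) p
  lookup-S-cycD l c p = begin
    lookup S (cycD l c p)                               ≡⟨ lookup-layer (onCycles ∘ S₅) l (cyc c p) ⟩
    lookup (concat (replicate k (S₅ l))) (combine c p)  ≡⟨ lookup-concat (replicate k (S₅ l)) c p ⟩
    lookup (lookup (replicate k (S₅ l)) c) p            ≡⟨ cong (λ r → lookup r p) (lookup-replicate c (S₅ l)) ⟩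
    lookup (S₅ l) p                                     ∎
    where open ≡-Reasoning

  lookup-S-hubD : ∀ l → lookup S (hubD l) ≡ outside
  lookup-S-hubD l = lookup-layer (onCycles ∘ S₅) l hub

  outside-∉S : ∀ {x} → lookup S x ≡ outside → x ∉ S
  outside-∉S x-out x∈S with () ← trans (sym ([]=⇒lookup x∈S)) x-out

  to-hubD : ∀ l c p → lookup (S₅ l) p ≡ inside →
            ClearWalk DG S (cycD l c p) (hubD false) (suc (c5dist p zero))
  to-hubD l c zero _ =
    edge (adj-cycD-hubD l false c zero)
  to-hubD l c (suc zero) _ =
    via (adj-cycD-same l true c _ zero) (outside-∉S (lookup-S-cycD true c zero))
    (edge (adj-cycD-hubD true false c zero))
  to-hubD l c (suc (suc zero)) _ =
    via (adj-cycD-same l false c _ (suc zero)) (outside-∉S (lookup-S-cycD false c (suc zero)))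
    (via (adj-cycD-same false true c _ zero) (outside-∉S (lookup-S-cycD true c zero))
    (edge (adj-cycD-hubD true false c zero)))
  to-hubD false c (suc (suc (suc zero))) ()
  to-hubD true  c (suc (suc (suc zero))) ()
  to-hubD l c (suc (suc (suc (suc zero)))) _ =
    via (adj-cycD-same l true c _ zero) (outside-∉S (lookup-S-cycD true c zero))
    (edge (adj-cycD-hubD true false c zero))

  visible-same-copy : ∀ l p l′ q c → lookup (S₅ l) p ≡ inside → lookup (S₅ l′) q ≡ inside →
                      Visible DG S (cycD l c p) (cycD l′ c q)
  visible-same-copy l p l′ q c p∈ q∈ = visible-if-common-neighbour DG _ _ middle
    where
    middle : adj DG (cycD l c p) (cycD l′ c q) ≡ false →
             ∃ λ u → adj DG (cycD l c p) u ≡ true × u ∉ S × adj DG u (cycD l′ c q) ≡ true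
    middle pq with S₅-common-neighbour l p l′ q p∈ q∈ (trans (sym (adj-cycD-same l l′ c p q)) pq)
    ... | l″ , r , r-out , pr , rq =
      cycD l″ c r , trans (adj-cycD-same l l″ c p r) pr ,
      outside-∉S (trans (lookup-S-cycD l″ c r) r-out) , trans (adj-cycD-same l″ l′ c r q) rq

  visible-other-copy : ∀ l p l′ q {c c′} → c′ ≢ c →
                       lookup (S₅ l) p ≡ inside → lookup (S₅ l′) q ≡ inside →
                       Visible DG S (cycD l c p) (cycD l′ c′ q)
  visible-other-copy l p l′ q {c} {c′} c′≢c p∈ q∈ = geodesic-visible DG route at-least
    where
    open Potential c p
    route : ClearWalk DG S (cycD l c p) (cycD l′ c′ q) (suc (c5dist p zero) + suc (c5dist q zero))
    route = splice DG (to-hubD l c p p∈) (outside-∉S (lookup-S-hubD false))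
                      (reverse DG (D-symmetric (Gk-symmetric k)) (to-hubD l′ c′ q q∈))
    at-least : ∀ {m} → Walk DG (cycD l c p) (cycD l′ c′ q) m →
               suc (c5dist p zero) + suc (c5dist q zero) ≤ m
    at-least {m} w = begin
      suc (c5dist p zero) + suc (c5dist q zero)   ≡⟨ ℕ.+-comm (suc (c5dist p zero)) _ ⟩
      suc (c5dist q zero) + suc (c5dist p zero)   ≡⟨ cong (λ d → suc d + suc (c5dist p zero)) (c5dist-sym q zero) ⟩
      suc (c5dist zero q) + suc (c5dist p zero)   ≡⟨ ℕ.+-suc (c5dist zero q) _ ⟨
      c5dist zero q + suc (suc (c5dist p zero))   ≡⟨ φ-other q c′≢c ⟨
      φ (cyc c′ q)                                ≤⟨ layer-walk-potential φ φ-lipschitz {l} {l′} w ⟩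
      m + φ (cyc c p)                             ≡⟨ cong (m +_) φ-source ⟩
      m + 0                                       ≡⟨ ℕ.+-identityʳ m ⟩
      m                                           ∎
      where open ℕ.≤-Reasoning

  ∈S⇒S₅ : ∀ l c p → cycD l c p ∈ S → lookup (S₅ l) p ≡ inside
  ∈S⇒S₅ l c p ∈S = trans (sym (lookup-S-cycD l c p)) ([]=⇒lookup ∈S)

  S-mutual-visibility : IsMutualVisibilitySet DG S
  S-mutual-visibility x y x∈S y∈S with layered-view x | layered-view y
  ... | layered l u | layered l′ v with vertex-view u | vertex-view v
  ...   | hubᵛ     | _        = contradiction x∈S (outside-∉S (lookup-S-hubD l))
  ...   | cycᵛ _ _ | hubᵛ     = contradiction y∈S (outside-∉S (lookup-S-hubD l′))
  ...   | cycᵛ c p | cycᵛ c′ q with c′ ≟ c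
  ...     | yes refl = visible-same-copy l p l′ q c (∈S⇒S₅ l c p x∈S) (∈S⇒S₅ l′ c q y∈S)
  ...     | no c′≢c  = visible-other-copy l p l′ q c′≢c (∈S⇒S₅ l c p x∈S) (∈S⇒S₅ l′ c′ q y∈S)

open DoubleCycles using (S; ∣S∣; S-mutual-visibility)

size-identity : ∀ m → m + (suc (suc m * 5) + 0) ≡ suc m * 3 + suc m * 3
size-identity = solve-∀

proposition3p4 : (k : ℕ) → 2 ≤ k → (a b : ℕ) → IsMu (D (Gk k)) a → IsMuT (Gk k) b →
    (k ∸ 1) + (n (Gk k) + b) ≤ a
proposition3p4 k@(suc k′) 2≤k a _ (_ , μ-maximal) ((T , T-total , refl) , _) = begin
  k′ + (n (Gk k) + ∣ T ∣)   ≡⟨ cong (λ t → k′ + (n (Gk k) + t)) μt≡0 ⟩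
  k′ + (n (Gk k) + 0)       ≡⟨ size-identity k′ ⟩
  k * 3 + k * 3             ≡⟨ ∣S∣ k ⟨
  ∣ S k ∣                   ≤⟨ μ-maximal (S k) (S-mutual-visibility k) ⟩
  a                         ∎
  where
  open ℕ.≤-Reasoning
  μt≡0 : ∣ T ∣ ≡ 0
  μt≡0 = total-mutual-visibility-empty (Gk k) (UniqueMiddles.every-vertex-unique-middle k 2≤k) T-total
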